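{- Let $\mathcal{L_N}$ be an elementary abelian $2$-group (written additively, identity $\Omega'$), let $\mathcal{L_Q}$ be a Steiner loop with identity $\bar\Omega$ and $|\mathcal{L_Q}|\le 4$, and let $f:\mathcal{L_Q}\times\mathcal{L_Q}\to\mathcal{L_N}$ be a symmetric function with $f(P,\bar\Omega)=\Omega'$ and $f(P,Q)=f(P,PQ)=f(Q,PQ)$ for all $P,Q\in\mathcal{L_Q}$. Let $\mathcal{L_S}$ be the Steiner loop on $\mathcal{L_Q}\times\mathcal{L_N}$ with operation $(P,x)\circ(Q,y)=(PQ,x+y+f(P,Q))$, and $\mathcal{S}=\mathcal{L_S}\setminus\{(\bar\Omega,\Omega')\}$ the corresponding Steiner triple system. Then $\mathcal{S}$ is projective.
   Context: A Steiner loop is the loop $\mathcal{S}\cup\{\Omega\}$ of a Steiner triple system $\mathcal{S}$ (set of points with triples such that every 2-subset lies in exactly one triple), with product: for distinct points, the third point of their triple; $xx=\Omega$; $x\Omega=\Omega x=x$. Conversely, the triples of the STS associated with a Steiner loop are the sets $\{a,b,ab\}$ for distinct non-identity $a,b$. A Steiner triple system is projective if it is isomorphic to the point-line design of a projective space $\mathrm{PG}(n,2)$; equivalently, its Steiner loop is a group. -}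

module Defs where

open import Level using (Level)
open import Data.Product using (_×_; _,_)
open import Relation.Binary.PropositionalEquality using (_≡_)
open import Algebra.Core using (Op₂)
open import Algebra.Definitions using (Associative)

-- A Steiner loop (the loop S ∪ {Ω} of a Steiner triple system S), given
-- by its standard algebraic axioms: Ω is a two-sided identity, the product is
-- commutative, x x = Ω, and x (x y) = y.  These are exactly the loops arising
-- from Steiner triple systems (triples {a, b, ab} for distinct non-identity a, b).
record IsSteinerLoop {a : Level} {L : Set a} (_∙_ : Op₂ L) (Ω : L) : Set a where
  field
    identityˡ : ∀ x → Ω ∙ x ≡ x
    identityʳ : ∀ x → x ∙ Ω ≡ x
    comm      : ∀ x y → x ∙ y ≡ y ∙ x
    square    : ∀ x → x ∙ x ≡ Ω
    cancel    : ∀ x y → x ∙ (x ∙ y) ≡ y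

-- The Steiner triple system S = L ∖ {Ω} associated with a Steiner loop
-- (L, ∙, Ω) is projective iff it is an STS (L is a Steiner loop) whose
-- Steiner loop is a group, i.e. the product is associative.
IsProjective : {a : Level} {L : Set a} (_∙_ : Op₂ L) (Ω : L) → Set a
IsProjective {L = L} _∙_ Ω = IsSteinerLoop _∙_ Ω × Associative _≡_ _∙_

extOp : {q n : Level} {Q : Set q} {N : Set n} →
        Op₂ Q → Op₂ N → (Q → Q → N) → Op₂ (Q × N)
extOp _·_ _+_ f (P , x) (R , y) = (P · R , (x + y) + f P R)

{-# OPTIONS --safe #-}

-- L_S is a Steiner loop because L_N has exponent 2 and f is symmetric,
-- normalised and constant on the triples {P, R, PR}.  It is associative as soon
-- as L_Q is and f is a cocycle: f(P,R) + f(PR,S) = f(R,S) + f(P,RS).  Both hold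
-- for every P, R, S generating a subloop of order at most four, by a direct
-- check of the few ways in which Ω̄, P, R, PR, S can fail to be distinct; when
-- |L_Q| ≤ 4 they can never all be distinct.

module Submission where

open import Defs
open import Level using (Level; _⊔_)
open import Algebra.Bundles using (CommutativeMonoid)
open import Algebra.Core using (Op₁; Op₂)
open import Algebra.Definitions using (Associative)
open import Algebra.Structures using (IsAbelianGroup; IsCommutativeMonoid)
import Algebra.Solver.CommutativeMonoid as CommutativeMonoidSolver
open import Data.Fin using (Fin)
import Data.Fin.Properties as Fin
open import Data.Nat using (ℕ; _≤_)
open import Data.Nat.Properties using (1+n≰n)
open import Data.Product using (_,_)
open import Data.Sum using (_⊎_; inj₁; inj₂)
open import Data.Vec using (Vec; []; _∷_)
open import Data.Vec.Relation.Unary.All using ([]; _∷_)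
open import Data.Vec.Relation.Unary.Unique.Propositional using (Unique; []; _∷_)
open import Data.Vec.Relation.Unary.Unique.Propositional.Properties using (lookup-injective)
open import Function using (_∘_)
open import Function.Bundles using (_↣_; Injection)
open import Relation.Binary.Definitions using (DecidableEquality)
open import Relation.Binary.PropositionalEquality
  using (_≡_; refl; sym; trans; cong; cong₂; module ≡-Reasoning)
open import Relation.Nullary using (Dec; ¬_)
open import Relation.Nullary.Decidable using (_⊎-dec_; decidable-stable; via-injection)

private
  variable
    a b : Level
    m n : ℕ

unique⇒length≤ : {A : Set a} {xs : Vec A m} → A ↣ Fin n → Unique xs → m ≤ n
unique⇒length≤ A↣Fin u =
  Fin.injective⇒≤ (lookup-injective u _ _ ∘ Injection.injective A↣Fin)

Cocycle : {Q : Set a} {N : Set b} → Op₂ Q → Op₂ N → (Q → Q → N) → Set (a ⊔ b)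
Cocycle _·_ _+_ f = ∀ P R S → f P R + f (P · R) S ≡ f R S + f P (R · S)

module SteinerLoopProperties {Q : Set a} {_·_ : Op₂ Q} {Ω̄ : Q}
                             (isSteinerLoop : IsSteinerLoop _·_ Ω̄) where

  open IsSteinerLoop isSteinerLoop public
    renaming ( identityˡ to ·-identityˡ; identityʳ to ·-identityʳ; comm to ·-comm
             ; square to ·-square; cancel to ·-cancel )

  y·[x·y]≡x : ∀ x y → y · (x · y) ≡ x
  y·[x·y]≡x x y = trans (cong (y ·_) (·-comm x y)) (·-cancel y x)

  ·-cancelʳ : ∀ x y → (x · y) · y ≡ x
  ·-cancelʳ x y = trans (·-comm (x · y) y) (y·[x·y]≡x x y)

  x·y≡Ω̄⇒x≡y : ∀ {x y} → x · y ≡ Ω̄ → x ≡ y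
  x·y≡Ω̄⇒x≡y {x} {y} e = trans (sym (·-identityʳ x)) (trans (cong (x ·_) (sym e)) (·-cancel x y))

  x·y≡x⇒y≡Ω̄ : ∀ {x y} → x · y ≡ x → y ≡ Ω̄
  x·y≡x⇒y≡Ω̄ {x} {y} e = trans (sym (·-cancel x y)) (trans (cong (x ·_) e) (·-square x))

  x·y≡y⇒x≡Ω̄ : ∀ {x y} → x · y ≡ y → x ≡ Ω̄
  x·y≡y⇒x≡Ω̄ {x} {y} e = x·y≡x⇒y≡Ω̄ (trans (·-comm y x) e)

  -- The subloop generated by P, R and S has at most four elements: a line of
  -- the triple system together with Ω̄.
  Collinear : Q → Q → Q → Set a
  Collinear P R S = P ≡ Ω̄ ⊎ R ≡ Ω̄ ⊎ S ≡ Ω̄ ⊎ P ≡ R ⊎ R ≡ S ⊎ P ≡ S ⊎ S ≡ P · R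

  pattern first-Ω̄       e = inj₁ e
  pattern second-Ω̄      e = inj₂ (inj₁ e)
  pattern third-Ω̄       e = inj₂ (inj₂ (inj₁ e))
  pattern first≡second  e = inj₂ (inj₂ (inj₂ (inj₁ e)))
  pattern second≡third  e = inj₂ (inj₂ (inj₂ (inj₂ (inj₁ e))))
  pattern first≡third   e = inj₂ (inj₂ (inj₂ (inj₂ (inj₂ (inj₁ e)))))
  pattern third≡product e = inj₂ (inj₂ (inj₂ (inj₂ (inj₂ (inj₂ e)))))

  collinear? : DecidableEquality Q → ∀ P R S → Dec (Collinear P R S)
  collinear? _≟_ P R S =
    P ≟ Ω̄ ⊎-dec R ≟ Ω̄ ⊎-dec S ≟ Ω̄ ⊎-dec P ≟ R ⊎-dec R ≟ S ⊎-dec P ≟ S ⊎-dec S ≟ (P · R)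

  collinear⇒assoc : ∀ {P R S} → Collinear P R S → (P · R) · S ≡ P · (R · S)
  collinear⇒assoc {R = R} {S} (first-Ω̄ refl) =
    trans (cong (_· S) (·-identityˡ R)) (sym (·-identityˡ (R · S)))
  collinear⇒assoc {P} {S = S} (second-Ω̄ refl) =
    trans (cong (_· S) (·-identityʳ P)) (cong (P ·_) (sym (·-identityˡ S)))
  collinear⇒assoc {P} {R} (third-Ω̄ refl) =
    trans (·-identityʳ (P · R)) (cong (P ·_) (sym (·-identityʳ R)))
  collinear⇒assoc {P} {S = S} (first≡second refl) =
    trans (cong (_· S) (·-square P)) (trans (·-identityˡ S) (sym (·-cancel P S)))
  collinear⇒assoc {P} {R} (second≡third refl) =
    trans (·-cancelʳ P R) (sym (trans (cong (P ·_) (·-square R)) (·-identityʳ P)))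
  collinear⇒assoc {P} {R} (first≡third refl) =
    trans (·-comm (P · R) P) (cong (P ·_) (·-comm P R))
  collinear⇒assoc {P} {R} (third≡product refl) =
    trans (·-square (P · R)) (sym (trans (cong (P ·_) (y·[x·y]≡x P R)) (·-square P)))

  ¬collinear⇒unique : ∀ {P R S} → ¬ Collinear P R S → Unique (Ω̄ ∷ P ∷ R ∷ P · R ∷ S ∷ [])
  ¬collinear⇒unique ¬c =
      (¬c ∘ first-Ω̄ ∘ sym ∷ ¬c ∘ second-Ω̄ ∘ sym ∷ ¬c ∘ first≡second ∘ x·y≡Ω̄⇒x≡y ∘ sym
        ∷ ¬c ∘ third-Ω̄ ∘ sym ∷ [])
    ∷ (¬c ∘ first≡second ∷ ¬c ∘ second-Ω̄ ∘ x·y≡x⇒y≡Ω̄ ∘ sym ∷ ¬c ∘ first≡third ∷ [])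
    ∷ (¬c ∘ first-Ω̄ ∘ x·y≡y⇒x≡Ω̄ ∘ sym ∷ ¬c ∘ second≡third ∷ [])
    ∷ (¬c ∘ third≡product ∘ sym ∷ [])
    ∷ [] ∷ []

  ↣Fin4⇒collinear : Q ↣ Fin 4 → ∀ P R S → Collinear P R S
  ↣Fin4⇒collinear Q↣Fin4 P R S =
    decidable-stable (collinear? (via-injection Q↣Fin4 Fin._≟_) P R S)
      (1+n≰n ∘ unique⇒length≤ Q↣Fin4 ∘ ¬collinear⇒unique)

module _ {N : Set b} {_+_ : Op₂ N} {ε : N}
         (isCommutativeMonoid : IsCommutativeMonoid _≡_ _+_ ε) where

  open IsCommutativeMonoid isCommutativeMonoid
    using () renaming (identityˡ to +-identityˡ; identityʳ to +-identityʳ; comm to +-comm)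

  +-commutativeMonoid : CommutativeMonoid b b
  +-commutativeMonoid = record { isCommutativeMonoid = isCommutativeMonoid }

  open CommutativeMonoidSolver +-commutativeMonoid using (solve; _⊜_; _⊕_)
  open ≡-Reasoning

  extOp-assoc : {Q : Set a} {_·_ : Op₂ Q} {f : Q → Q → N} →
                Associative _≡_ _·_ → Cocycle _·_ _+_ f → Associative _≡_ (extOp _·_ _+_ f)
  extOp-assoc {_·_ = _·_} {f} ·-assoc cocycle (P , x) (R , y) (S , z) =
    cong₂ _,_ (·-assoc P R S) (begin
      (((x + y) + f P R) + z) + f (P · R) S
        ≡⟨ solve 5 (λ x y z u v → (((x ⊕ y) ⊕ u) ⊕ z) ⊕ v ⊜ ((x ⊕ y) ⊕ z) ⊕ (u ⊕ v))
                 refl x y z (f P R) (f (P · R) S) ⟩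
      ((x + y) + z) + (f P R + f (P · R) S)
        ≡⟨ cong (((x + y) + z) +_) (cocycle P R S) ⟩
      ((x + y) + z) + (f R S + f P (R · S))
        ≡⟨ solve 5 (λ x y z u v → ((x ⊕ y) ⊕ z) ⊕ (u ⊕ v) ⊜ (x ⊕ ((y ⊕ z) ⊕ u)) ⊕ v)
                 refl x y z (f R S) (f P (R · S)) ⟩
      (x + ((y + z) + f R S)) + f P (R · S) ∎)

  module SteinerExtension
    {Q : Set a} {_·_ : Op₂ Q} {Ω̄ : Q} (isSteinerLoop : IsSteinerLoop _·_ Ω̄)
    (x+x≡ε : ∀ x → x + x ≡ ε)
    (f : Q → Q → N)
    (f-comm : ∀ P R → f P R ≡ f R P)
    (f-identityʳ : ∀ P → f P Ω̄ ≡ ε)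
    (f-triple : ∀ P R → f P R ≡ f P (P · R))
    where

    open SteinerLoopProperties isSteinerLoop

    f-identityˡ : ∀ P → f Ω̄ P ≡ ε
    f-identityˡ P = trans (f-comm Ω̄ P) (f-identityʳ P)

    f-diag : ∀ P → f P P ≡ ε
    f-diag P = trans (f-triple P P) (trans (cong (f P) (·-square P)) (f-identityʳ P))

    f-tripleʳ : ∀ P R → f P R ≡ f R (P · R)
    f-tripleʳ P R = trans (f-comm P R) (trans (f-triple R P) (cong (f R) (·-comm R P)))

    collinear⇒cocycle : ∀ {P R S} → Collinear P R S →
                        f P R + f (P · R) S ≡ f R S + f P (R · S)
    collinear⇒cocycle {R = R} {S} (first-Ω̄ refl) = begin
      f Ω̄ R + f (Ω̄ · R) S  ≡⟨ cong₂ _+_ (f-identityˡ R) (cong (λ X → f X S) (·-identityˡ R)) ⟩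
      ε + f R S            ≡⟨ +-comm ε (f R S) ⟩
      f R S + ε            ≡⟨ cong (f R S +_) (f-identityˡ (R · S)) ⟨
      f R S + f Ω̄ (R · S)  ∎
    collinear⇒cocycle {P} {S = S} (second-Ω̄ refl) = begin
      f P Ω̄ + f (P · Ω̄) S  ≡⟨ cong₂ _+_ (f-identityʳ P) (cong (λ X → f X S) (·-identityʳ P)) ⟩
      ε + f P S            ≡⟨ cong₂ _+_ (f-identityˡ S) (cong (f P) (·-identityˡ S)) ⟨
      f Ω̄ S + f P (Ω̄ · S)  ∎
    collinear⇒cocycle {P} {R} (third-Ω̄ refl) = begin
      f P R + f (P · R) Ω̄  ≡⟨ cong (f P R +_) (f-identityʳ (P · R)) ⟩
      f P R + ε            ≡⟨ +-comm (f P R) ε ⟩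
      ε + f P R            ≡⟨ cong₂ _+_ (f-identityʳ R) (cong (f P) (·-identityʳ R)) ⟨
      f R Ω̄ + f P (R · Ω̄)  ∎
    collinear⇒cocycle {P} {S = S} (first≡second refl) = begin
      f P P + f (P · P) S
        ≡⟨ cong₂ _+_ (f-diag P) (trans (cong (λ X → f X S) (·-square P)) (f-identityˡ S)) ⟩
      ε + ε                ≡⟨ x+x≡ε ε ⟩
      ε                    ≡⟨ x+x≡ε (f P S) ⟨
      f P S + f P S        ≡⟨ cong (f P S +_) (f-triple P S) ⟩
      f P S + f P (P · S)  ∎
    collinear⇒cocycle {P} {R} (second≡third refl) = begin
      f P R + f (P · R) R  ≡⟨ cong (f P R +_) (trans (f-tripleʳ P R) (f-comm R (P · R))) ⟨
      f P R + f P R        ≡⟨ x+x≡ε (f P R) ⟩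
      ε                    ≡⟨ x+x≡ε ε ⟨
      ε + ε
        ≡⟨ cong₂ _+_ (f-diag R) (trans (cong (f P) (·-square R)) (f-identityʳ P)) ⟨
      f R R + f P (R · R)  ∎
    collinear⇒cocycle {P} {R} (first≡third refl) =
      cong₂ _+_ (f-comm P R) (trans (f-comm (P · R) P) (cong (f P) (·-comm P R)))
    collinear⇒cocycle {P} {R} (third≡product refl) = begin
      f P R + f (P · R) (P · R)        ≡⟨ cong (f P R +_) (f-diag (P · R)) ⟩
      f P R + ε                        ≡⟨ cong₂ _+_ (f-tripleʳ P R) (sym (f-diag P)) ⟩
      f R (P · R) + f P P              ≡⟨ cong (λ X → f R (P · R) + f P X) (y·[x·y]≡x P R) ⟨
      f R (P · R) + f P (R · (P · R))  ∎

    extOp-isSteinerLoop : IsSteinerLoop (extOp _·_ _+_ f) (Ω̄ , ε)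
    extOp-isSteinerLoop .IsSteinerLoop.identityˡ (P , x) =
      cong₂ _,_ (·-identityˡ P) (trans (cong₂ _+_ (+-identityˡ x) (f-identityˡ P)) (+-identityʳ x))
    extOp-isSteinerLoop .IsSteinerLoop.identityʳ (P , x) =
      cong₂ _,_ (·-identityʳ P) (trans (cong₂ _+_ (+-identityʳ x) (f-identityʳ P)) (+-identityʳ x))
    extOp-isSteinerLoop .IsSteinerLoop.comm (P , x) (R , y) =
      cong₂ _,_ (·-comm P R) (cong₂ _+_ (+-comm x y) (f-comm P R))
    extOp-isSteinerLoop .IsSteinerLoop.square (P , x) =
      cong₂ _,_ (·-square P) (trans (cong₂ _+_ (x+x≡ε x) (f-diag P)) (+-identityʳ ε))
    extOp-isSteinerLoop .IsSteinerLoop.cancel (P , x) (R , y) =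
      cong₂ _,_ (·-cancel P R) (begin
        (x + ((x + y) + f P R)) + f P (P · R)
          ≡⟨ cong ((x + ((x + y) + f P R)) +_) (f-triple P R) ⟨
        (x + ((x + y) + f P R)) + f P R
          ≡⟨ solve 3 (λ x y u → (x ⊕ ((x ⊕ y) ⊕ u)) ⊕ u ⊜ (x ⊕ x) ⊕ ((u ⊕ u) ⊕ y))
                   refl x y (f P R) ⟩
        (x + x) + ((f P R + f P R) + y)
          ≡⟨ cong₂ (λ u v → u + (v + y)) (x+x≡ε x) (x+x≡ε (f P R)) ⟩
        ε + (ε + y)                            ≡⟨ trans (+-identityˡ (ε + y)) (+-identityˡ y) ⟩
        y                                      ∎)

mainTheorem9 : (N : Set) (_+_ : Op₂ N) (Ω′ : N) (-_ : Op₁ N) →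
               IsAbelianGroup _≡_ _+_ Ω′ -_ →
               (∀ x → x + x ≡ Ω′) →
               (Q : Set) (_·_ : Op₂ Q) (Ω̄ : Q) →
               IsSteinerLoop _·_ Ω̄ →
               (Q ↣ Fin 4) →
               (f : Q → Q → N) →
               (∀ P R → f P R ≡ f R P) →
               (∀ P → f P Ω̄ ≡ Ω′) →
               (∀ P R → f P R ≡ f P (P · R)) →
               (∀ P R → f P R ≡ f R (P · R)) →
               IsProjective (extOp _·_ _+_ f) (Ω̄ , Ω′)
-- The last hypothesis is redundant: see f-tripleʳ.
mainTheorem9 N _+_ Ω′ -_ isAbelianGroup x+x≡Ω′ Q _·_ Ω̄ isSteinerLoop Q↣Fin4
             f f-comm f-identityʳ f-triple _ =
  extOp-isSteinerLoop ,
  extOp-assoc isCommutativeMonoid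
    (λ P R S → collinear⇒assoc (collinear P R S))
    (λ P R S → collinear⇒cocycle (collinear P R S))
  where
  isCommutativeMonoid : IsCommutativeMonoid _≡_ _+_ Ω′
  isCommutativeMonoid = IsAbelianGroup.isCommutativeMonoid isAbelianGroup

  open SteinerLoopProperties isSteinerLoop using (Collinear; collinear⇒assoc; ↣Fin4⇒collinear)
  open SteinerExtension isCommutativeMonoid isSteinerLoop x+x≡Ω′ f f-comm f-identityʳ f-triple
    using (collinear⇒cocycle; extOp-isSteinerLoop)

  collinear : ∀ P R S → Collinear P R S
  collinear = ↣Fin4⇒collinear Q↣Fin4
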